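{- There exist infinitely many positive integers $n$ such that $m(n)=n$.
   Context: For a positive integer $n$, $m(n)$ denotes the number of ordered factorizations of $n$ into factors larger than $1$, i.e. the number of finite sequences $(d_1,\dots,d_r)$, $r\ge 1$, of integers $d_i\ge 2$ with $d_1\cdots d_r=n$. -}

module Defs where

open import Data.Nat using (ℕ; _≤_; _<_)
open import Data.List using (List; []; _∷_)
open import Data.Nat.ListAction using (product)
open import Data.List.Relation.Unary.All using (All)
open import Data.Product using (Σ; _×_)
open import Relation.Binary.PropositionalEquality using (_≡_)
open import Relation.Nullary using (¬_)

OrderedFactorization : ℕ → Set
OrderedFactorization n =
  Σ (List ℕ) (λ ds → ¬ (ds ≡ []) × All (2 ≤_) ds × product ds ≡ n)

{-# OPTIONS --safe #-}
-- Classify a factorization of 2n by its first factor d: d = 2, d = 2x with x ≥ 2, or d odd.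
-- Writing f(n) for the number of factorizations including the empty one of 1 (so f = m except at 1),
-- this gives f(2n) = f(n) + m(n) + #(factorizations of 2n with odd first factor).
-- For n = 2ᵗ there are none of the last kind, so m(2ᵗ⁺¹) = 2ᵗ. For n = 2ᵗq with q an odd prime the
-- odd first factor must be q, followed by a factorization of 2ᵗ⁺¹, so m(2ᵗ⁺¹q) = 2m(2ᵗq) + 2ᵗ, that
-- is, m(2ᵗ⁺¹q) = 2ᵗ(t + 3). This equals 2ᵗ⁺¹q when t = 2q − 3, and there are infinitely many odd primes.
module Submission where

open import Defs
open import Data.Nat using (ℕ; _<_)
open import Data.Fin using (Fin)
open import Data.Product using (Σ; _×_)
open import Function.Bundles using (_↔_)

open import Data.Nat
  using (zero; suc; _+_; _*_; _^_; _!; _≤_; z≤n; s≤s; _≤?_; nonTrivial⇒n>1; >-nonZero; >-nonZero⁻¹)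
open import Data.Nat.Properties
open import Data.Nat.Divisibility
  using (_∣_; divides; m∣m*n; n∣m*n; ∣-trans; ∣1⇒≡1; ∣m+n∣m⇒∣n; m≤n⇒m!∣n!)
open import Data.Nat.Coprimality using (Coprime; 1-coprimeTo; coprime-+; coprime-divisor)
open import Data.Nat.Primality
  using (Prime; prime[2]; prime⇒irreducible; prime⇒nonTrivial; prime⇒nonZero)
open import Data.Nat.Primality.Factorisation using (factorise)
open import Data.Nat.ListAction using (product)
open import Data.Nat.Tactic.RingSolver using (solve-∀)
open import Data.List using (List; []; _∷_)
open import Data.List.Relation.Unary.All as All using (All; []; _∷_)
open import Data.Product using (_,_; proj₁; proj₂)
open import Data.Sum using (_⊎_; inj₁; inj₂; [_,_])
open import Data.Unit using (tt)
open import Data.Empty using (⊥-elim)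
open import Data.Fin.Properties using (+↔⊎; 1↔⊤)
open import Data.Sum.Function.Propositional using (_⊎-cong_)
open import Function using (id; _∘_)
open import Function.Bundles using (mk↔ₛ′)
open import Function.Properties.Inverse using (↔-refl; ↔-sym; ↔-trans)
open import Function.Related.Propositional using (module EquationalReasoning)
open import Relation.Binary.PropositionalEquality using (_≡_; refl; sym; trans; cong; cong₂; subst)
open import Relation.Nullary using (¬_; yes; no; contradiction)
open import Relation.Nullary.Irrelevant using (Irrelevant)

⊎-identityʳ-¬ : {A B : Set} → ¬ B → (A ⊎ B) ↔ A
⊎-identityʳ-¬ ¬b =
  mk↔ₛ′ [ id , ⊥-elim ∘ ¬b ] inj₁ (λ _ → refl) [ (λ _ → refl) , ⊥-elim ∘ ¬b ]

data EvenOdd : ℕ → Set where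
  even : ∀ k → EvenOdd (k * 2)
  odd  : ∀ k → EvenOdd (1 + k * 2)

evenOdd : ∀ n → EvenOdd n
evenOdd 0 = even 0
evenOdd 1 = odd 0
evenOdd (suc (suc n)) with evenOdd n
... | even k = even (suc k)
... | odd k  = odd (suc k)

evenOdd-even : ∀ k → evenOdd (k * 2) ≡ even k
evenOdd-even zero = refl
evenOdd-even (suc k) rewrite evenOdd-even k = refl

evenOdd-odd : ∀ k → evenOdd (1 + k * 2) ≡ odd k
evenOdd-odd zero = refl
evenOdd-odd (suc k) rewrite evenOdd-odd k = refl

odd-coprime-2 : ∀ k → Coprime (1 + k * 2) 2
odd-coprime-2 zero = 1-coprimeTo 2
odd-coprime-2 (suc k) = coprime-+ (odd-coprime-2 k)

odd∣2^t*m⇒∣m : ∀ k t {m} → 1 + k * 2 ∣ 2 ^ t * m → 1 + k * 2 ∣ m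
odd∣2^t*m⇒∣m k zero {m} d∣m = subst (1 + k * 2 ∣_) (*-identityˡ m) d∣m
odd∣2^t*m⇒∣m k (suc t) {m} d∣2^[1+t]m =
  odd∣2^t*m⇒∣m k t 
    (coprime-divisor (odd-coprime-2 k) (subst (1 + k * 2 ∣_) (*-assoc 2 (2 ^ t) m) d∣2^[1+t]m))

0<m≤n⇒m∣n! : ∀ {m n} → 0 < m → m ≤ n → m ∣ n !
0<m≤n⇒m∣n! {suc m} _ m≤n = ∣-trans (m∣m*n (m !)) (m≤n⇒m!∣n! m≤n)

prime-factor : ∀ n → 1 < n → Σ ℕ λ p → Prime p × p ∣ n
prime-factor n 1<n with factorise n {{>-nonZero (<-trans (s≤s z≤n) 1<n)}}
... | record { factors = [] ; isFactorisation = n≡1 } = contradiction (sym n≡1) (<⇒≢ 1<n)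
... | record { factors = p ∷ ps ; isFactorisation = n≡p*ps ; factorsPrime = prime-p ∷ _ } =
  p , prime-p , divides (product ps) (trans n≡p*ps (*-comm p (product ps)))

-- Euclid: a prime factor of n! + 1 cannot be at most n.
prime-above : ∀ n → Σ ℕ λ p → n < p × Prime p
prime-above n with prime-factor (suc (n !)) (s≤s (>-nonZero⁻¹ (n !) {{n !≢0}}))
... | p , prime-p , p∣1+n! with p ≤? n
...   | no p≰n = p , ≰⇒> p≰n , prime-p
...   | yes p≤n = contradiction (∣1⇒≡1 p∣1) (>⇒≢ 1<p)
  where
  1<p : 1 < p
  1<p = nonTrivial⇒n>1 p {{prime⇒nonTrivial prime-p}}
  p∣1 : p ∣ 1
  p∣1 = ∣m+n∣m⇒∣n (subst (p ∣_) (+-comm 1 (n !)) p∣1+n!)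
                   (0<m≤n⇒m∣n! (<-trans (s≤s z≤n) 1<p) p≤n)

odd-prime-above : ∀ n → Σ ℕ λ j → n < 3 + j * 2 × Prime (3 + j * 2)
odd-prime-above n with prime-above (2 + n)
... | p , 2+n<p , prime-p with evenOdd p
...   | odd (suc j) = j , <-trans (m<n+m n (s≤s z≤n)) 2+n<p , prime-p
...   | odd 0 = contradiction 2+n<p λ { (s≤s ()) }
...   | even x with prime⇒irreducible prime-p (n∣m*n x)
...     | inj₁ ()
...     | inj₂ 2≡x*2 = contradiction (subst (2 + n <_) (sym 2≡x*2) 2+n<p) (λ { (s≤s (s≤s ())) })

IsFactorization : ℕ → List ℕ → Set
IsFactorization n ds = All (2 ≤_) ds × product ds ≡ n

Factorization : ℕ → Set
Factorization n = Σ (List ℕ) (IsFactorization n)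

-- The odd first factor is written 3 + 2k, so that oddness needs no proof field.
OddHeaded : ℕ → Set
OddHeaded n = Σ ℕ λ k → Σ (List ℕ) λ rs → IsFactorization n (3 + k * 2 ∷ rs)

isFactorization-irrelevant : ∀ {n ds} → Irrelevant (IsFactorization n ds)
isFactorization-irrelevant (ps , e) (ps′ , e′) =
  cong₂ _,_ (All.irrelevant ≤-irrelevant ps ps′) (≡-irrelevant e e′)

Factorization-≡ : ∀ {n} {f g : Factorization n} → proj₁ f ≡ proj₁ g → f ≡ g
Factorization-≡ {f = ds , i} {_ , j} refl = cong (ds ,_) (isFactorization-irrelevant i j)

-- The ¬ (ds ≡ []) components need no argument: ⊥ is definitionally proof-irrelevant.
OrderedFactorization-≡ : ∀ {n} {f g : OrderedFactorization n} → proj₁ f ≡ proj₁ g → f ≡ g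
OrderedFactorization-≡ {f = ds , _ , i} {_ , _ , j} refl =
  cong (λ i → ds , _ , i) (isFactorization-irrelevant i j)

OrderedFactorization↔Factorization : ∀ {n} → 1 < n → OrderedFactorization n ↔ Factorization n
OrderedFactorization↔Factorization {n} 1<n = mk↔ₛ′ to from to∘from from∘to
  where
  to : OrderedFactorization n → Factorization n
  to (ds , _ , f) = ds , f
  from : Factorization n → OrderedFactorization n
  from ([] , _ , 1≡n) = contradiction 1≡n (<⇒≢ 1<n)
  from (d ∷ rs , f) = d ∷ rs , (λ ()) , f
  to∘from : ∀ f → to (from f) ≡ f
  to∘from ([] , _ , 1≡n) = contradiction 1≡n (<⇒≢ 1<n)
  to∘from (d ∷ rs , f) = refl
  from∘to : ∀ f → from (to f) ≡ f
  from∘to ([] , ds≢[] , _) = contradiction refl ds≢[]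
  from∘to (d ∷ rs , _) = refl

head∣n : ∀ {n d rs} → IsFactorization n (d ∷ rs) → d ∣ n
head∣n {rs = rs} (_ , e) = subst (_ ∣_) e (m∣m*n (product rs))

factors-of-1 : ∀ {ds} → IsFactorization 1 ds → ds ≡ []
factors-of-1 {[]} _ = refl
factors-of-1 {d ∷ rs} (2≤d ∷ _ , e) = contradiction (m*n≡1⇒m≡1 d (product rs) e) (>⇒≢ 2≤d)

Factorization-prime : ∀ {p} → Prime p → Factorization p ↔ Fin 1
Factorization-prime {p} pp =
  ↔-trans (mk↔ₛ′ (λ _ → tt) (λ _ → single) (λ _ → refl) single-unique) (↔-sym 1↔⊤)
  where
  1<p : 1 < p
  1<p = nonTrivial⇒n>1 p {{prime⇒nonTrivial pp}}
  single : Factorization p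
  single = p ∷ [] , 1<p ∷ [] , *-identityʳ p
  single-unique : ∀ f → single ≡ f
  single-unique ([] , _ , 1≡p) = contradiction (sym 1≡p) (>⇒≢ 1<p)
  single-unique (d ∷ rs , f@(2≤d ∷ ps , e)) with prime⇒irreducible pp (head∣n f)
  ... | inj₁ refl = contradiction 2≤d λ { (s≤s ()) }
  ... | inj₂ refl = Factorization-≡ (cong (d ∷_) (sym (factors-of-1 (ps , rs≡1))))
    where
    rs≡1 : product rs ≡ 1
    rs≡1 = *-cancelˡ-≡ (product rs) 1 d {{prime⇒nonZero pp}} (trans e (sym (*-identityʳ d)))

x*2*y≡2*[x*y] : ∀ x y → x * 2 * y ≡ 2 * (x * y)
x*2*y≡2*[x*y] = solve-∀

Factorization-2* : ∀ n →
  Factorization (2 * n) ↔ ((Factorization n ⊎ OrderedFactorization n) ⊎ OddHeaded (2 * n))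
Factorization-2* n = mk↔ₛ′ to from to∘from from∘to
  where
  Split : Set
  Split = (Factorization n ⊎ OrderedFactorization n) ⊎ OddHeaded (2 * n)

  halve : ∀ x rs → x * 2 * product rs ≡ 2 * n → x * product rs ≡ n
  halve x rs e = *-cancelˡ-≡ (x * product rs) n 2 (trans (sym (x*2*y≡2*[x*y] x (product rs))) e)

  byHead : ∀ {d} → EvenOdd d → ∀ rs → IsFactorization (2 * n) (d ∷ rs) → Split
  byHead (even 0) rs (() ∷ _ , _)
  byHead (even 1) rs (_ ∷ ps , e) =
    inj₁ (inj₁ (rs , ps , trans (sym (*-identityˡ (product rs))) (halve 1 rs e)))
  byHead (even x@(suc (suc _))) rs (_ ∷ ps , e) =
    inj₁ (inj₂ (x ∷ rs , (λ ()) , s≤s (s≤s z≤n) ∷ ps , halve x rs e))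
  byHead (odd 0) rs (s≤s () ∷ _ , _)
  byHead (odd (suc k)) rs f = inj₂ (k , rs , f)

  to : Factorization (2 * n) → Split
  to ([] , _ , 1≡2n) = contradiction (sym 1≡2n) (even≢odd n 0)
  to (d ∷ rs , f) = byHead (evenOdd d) rs f

  from : Split → Factorization (2 * n)
  from (inj₁ (inj₁ (rs , ps , e))) = 2 ∷ rs , ≤-refl ∷ ps , cong (2 *_) e
  from (inj₁ (inj₂ ([] , []≢[] , _))) = contradiction refl []≢[]
  from (inj₁ (inj₂ (x ∷ rs , _ , 2≤x ∷ ps , e))) =
    x * 2 ∷ rs , ≤-trans 2≤x (m≤m*n x 2) ∷ ps , trans (x*2*y≡2*[x*y] x (product rs)) (cong (2 *_) e)
  from (inj₂ (k , rs , f)) = 3 + k * 2 ∷ rs , f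

  to∘from : ∀ s → to (from s) ≡ s
  to∘from (inj₁ (inj₁ _)) = cong (inj₁ ∘ inj₁) (Factorization-≡ refl)
  to∘from (inj₁ (inj₂ ([] , []≢[] , _))) = contradiction refl []≢[]
  to∘from (inj₁ (inj₂ (x ∷ rs , _ , s≤s (s≤s _) ∷ _ , _))) rewrite evenOdd-even x =
    cong (inj₁ ∘ inj₂) (OrderedFactorization-≡ refl)
  to∘from (inj₂ (k , _ , _)) rewrite evenOdd-odd (suc k) = refl

  from∘byHead : ∀ {d} (v : EvenOdd d) rs f → from (byHead v rs f) ≡ (d ∷ rs , f)
  from∘byHead (even 0) rs (() ∷ _ , _)
  from∘byHead (even 1) rs (_ ∷ _ , _) = Factorization-≡ refl
  from∘byHead (even (suc (suc _))) rs (_ ∷ _ , _) = Factorization-≡ refl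
  from∘byHead (odd 0) rs (s≤s () ∷ _ , _)
  from∘byHead (odd (suc k)) rs f = refl

  from∘to : ∀ f → from (to f) ≡ f
  from∘to ([] , _ , 1≡2n) = contradiction (sym 1≡2n) (even≢odd n 0)
  from∘to (d ∷ rs , f) = from∘byHead (evenOdd d) rs f

OddHeaded-2^-empty : ∀ t → ¬ OddHeaded (2 ^ t)
OddHeaded-2^-empty t (k , _ , f) = contradiction (∣1⇒≡1 d∣1) λ ()
  where
  d∣1 : 3 + k * 2 ∣ 1
  d∣1 = odd∣2^t*m⇒∣m (suc k) t (subst (3 + k * 2 ∣_) (sym (*-identityʳ (2 ^ t))) (head∣n f))

1<2^[1+t] : ∀ t → 1 < 2 ^ suc t
1<2^[1+t] t = *-monoʳ-≤ 2 (m^n>0 2 t)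

1<n⇒1<2^t*n : ∀ t {n} → 1 < n → 1 < 2 ^ t * n
1<n⇒1<2^t*n t {n} 1<n = <-≤-trans 1<n (m≤n*m n (2 ^ t) {{m^n≢0 2 t}})

Factorization-2^[1+t] : ∀ t → Factorization (2 ^ suc t) ↔ Fin (2 ^ t)
Factorization-2^[1+t] zero = Factorization-prime prime[2]
Factorization-2^[1+t] (suc t) = begin
  Factorization (2 * 2 ^ suc t)
    ↔⟨ Factorization-2* (2 ^ suc t) ⟩
  ((Factorization (2 ^ suc t) ⊎ OrderedFactorization (2 ^ suc t)) ⊎ OddHeaded (2 ^ suc (suc t)))
    ↔⟨ ⊎-identityʳ-¬ (OddHeaded-2^-empty (suc (suc t))) ⟩
  (Factorization (2 ^ suc t) ⊎ OrderedFactorization (2 ^ suc t))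
    ↔⟨ IH ⊎-cong ↔-trans (OrderedFactorization↔Factorization (1<2^[1+t] t)) IH ⟩
  (Fin (2 ^ t) ⊎ Fin (2 ^ t))
    ↔⟨ +↔⊎ ⟨
  Fin (2 ^ t + 2 ^ t)
    ≡⟨ cong (λ m → Fin (2 ^ t + m)) (sym (+-identityʳ (2 ^ t))) ⟩
  Fin (2 ^ suc t) ∎
  where
  open EquationalReasoning
  IH = Factorization-2^[1+t] t

module _ (j : ℕ) (prime-q : Prime (3 + j * 2)) where

  private
    q : ℕ
    q = 3 + j * 2

  1<q : 1 < q
  1<q = s≤s (s≤s z≤n)

  oddHead-2^t*q : ∀ t k {rs} →
    IsFactorization (2 ^ t * q) (3 + k * 2 ∷ rs) → k ≡ j × product rs ≡ 2 ^ t
  oddHead-2^t*q t k {rs} f@(_ , e) with prime⇒irreducible prime-q (odd∣2^t*m⇒∣m (suc k) t (head∣n f))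
  ... | inj₁ ()
  ... | inj₂ d≡q = k≡j , *-cancelˡ-≡ (product rs) (2 ^ t) q q*rs≡q*2^t
    where
    k≡j : k ≡ j
    k≡j = *-cancelʳ-≡ k j 2 (+-cancelˡ-≡ 3 _ _ d≡q)
    q*rs≡q*2^t : q * product rs ≡ q * 2 ^ t
    q*rs≡q*2^t = trans (cong (_* product rs) (sym d≡q)) (trans e (*-comm (2 ^ t) q))

  OddHeaded-2^t*q : ∀ t → OddHeaded (2 ^ t * q) ↔ Factorization (2 ^ t)
  OddHeaded-2^t*q t = mk↔ₛ′ to from to∘from from∘to
    where
    to : OddHeaded (2 ^ t * q) → Factorization (2 ^ t)
    to (k , rs , f@(_ ∷ ps , _)) = rs , ps , proj₂ (oddHead-2^t*q t k f)
    from : Factorization (2 ^ t) → OddHeaded (2 ^ t * q)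
    from (rs , ps , e) = j , rs , s≤s (s≤s z≤n) ∷ ps , trans (cong (q *_) e) (*-comm q (2 ^ t))
    to∘from : ∀ f → to (from f) ≡ f
    to∘from _ = Factorization-≡ refl
    from∘to : ∀ h → from (to h) ≡ h
    from∘to (k , rs , f@(_ ∷ _ , _)) with refl ← proj₁ (oddHead-2^t*q t k f) =
      cong (λ f → j , rs , f) (isFactorization-irrelevant _ f)

  Factorization-2^[1+t]*q-step : ∀ t {a b} →
    Factorization (2 ^ t * q) ↔ Fin a → Factorization (2 ^ suc t) ↔ Fin b →
    Factorization (2 ^ suc t * q) ↔ Fin (a + a + b)
  Factorization-2^[1+t]*q-step t {a} {b} F↔a F↔b = begin
    Factorization (2 ^ suc t * q)
      ≡⟨ cong Factorization 2^[1+t]*q≡2*[2^t*q] ⟩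
    Factorization (2 * (2 ^ t * q))
      ↔⟨ Factorization-2* (2 ^ t * q) ⟩
    ((Factorization (2 ^ t * q) ⊎ OrderedFactorization (2 ^ t * q)) ⊎ OddHeaded (2 * (2 ^ t * q)))
      ↔⟨ (F↔a ⊎-cong OF↔a) ⊎-cong OH↔b ⟩
    ((Fin a ⊎ Fin a) ⊎ Fin b)
      ↔⟨ +↔⊎ ⊎-cong ↔-refl ⟨
    (Fin (a + a) ⊎ Fin b)
      ↔⟨ +↔⊎ ⟨
    Fin (a + a + b) ∎
    where
    open EquationalReasoning
    2^[1+t]*q≡2*[2^t*q] : 2 ^ suc t * q ≡ 2 * (2 ^ t * q)
    2^[1+t]*q≡2*[2^t*q] = *-assoc 2 (2 ^ t) q
    OF↔a : OrderedFactorization (2 ^ t * q) ↔ Fin a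
    OF↔a = ↔-trans (OrderedFactorization↔Factorization (1<n⇒1<2^t*n t 1<q)) F↔a
    OH↔b : OddHeaded (2 * (2 ^ t * q)) ↔ Fin b
    OH↔b = subst (λ m → OddHeaded m ↔ Fin b) 2^[1+t]*q≡2*[2^t*q]
                 (↔-trans (OddHeaded-2^t*q (suc t)) F↔b)

  Factorization-2^[1+t]*q↔Fin : ∀ t → Factorization (2 ^ suc t * q) ↔ Fin (2 ^ t * (t + 3))
  Factorization-2^[1+t]*q↔Fin zero =
    Factorization-2^[1+t]*q-step 0
      (Factorization-prime (subst Prime (sym (*-identityˡ q)) prime-q)) (Factorization-2^[1+t] 0)
  Factorization-2^[1+t]*q↔Fin (suc t) =
    subst (λ m → Factorization (2 ^ suc (suc t) * q) ↔ Fin m) (count-step (2 ^ t) t)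
      (Factorization-2^[1+t]*q-step (suc t)
        (Factorization-2^[1+t]*q↔Fin t) (Factorization-2^[1+t] (suc t)))
    where
    count-step : ∀ x t → x * (t + 3) + x * (t + 3) + 2 * x ≡ 2 * x * (suc t + 3)
    count-step = solve-∀

proposition12 : (k : ℕ) → Σ ℕ (λ n → (k < n) × (OrderedFactorization n ↔ Fin n))
proposition12 k with odd-prime-above k
... | j , k<q , prime-q = n , <-≤-trans k<q (m≤n*m q (2 ^ suc t) {{m^n≢0 2 (suc t)}}) , m[n]↔n
  where
  open EquationalReasoning
  q t n : ℕ
  q = 3 + j * 2
  t = 3 + j * 4
  n = 2 ^ suc t * q
  -- t is chosen so that t + 3 = 2q.
  count≡n : ∀ x j → x * (3 + j * 4 + 3) ≡ 2 * x * (3 + j * 2)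
  count≡n = solve-∀
  m[n]↔n : OrderedFactorization n ↔ Fin n
  m[n]↔n = begin
    OrderedFactorization n  ↔⟨ OrderedFactorization↔Factorization (1<n⇒1<2^t*n (suc t) (s≤s (s≤s z≤n))) ⟩
    Factorization n         ↔⟨ Factorization-2^[1+t]*q↔Fin j prime-q t ⟩
    Fin (2 ^ t * (t + 3))   ≡⟨ cong Fin (count≡n (2 ^ t) j) ⟩
    Fin n                   ∎
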